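{- Let $\lambda$ be a partition with at most $n$ nonzero parts (set $\lambda_i=0$ for $i$ beyond its length). The Grassmannian permutation $w_{\lambda,n}$ is inverse fireworks if and only if $\lambda$ is a strict partition.
   Context: A permutation $w$ is $n$-Grassmannian if $w(i)<w(i+1)$ for all $i\ne n$. Given a partition $\lambda$ with length at most $n$, $w_{\lambda,n}$ is the unique $n$-Grassmannian permutation (in a symmetric group $\mathbf{S}_N$ with $N$ large enough) such that for each $1\le i\le n$ there are exactly $\lambda_i$ values $v>n$ with $w_{\lambda,n}(v)<w_{\lambda,n}(n+1-i)$. A permutation $u$ is fireworks if, when its one-line notation is split into maximal decreasing runs (maximal consecutive decreasing segments), the initial elements of these runs appear in increasing order; $w$ is inverse fireworks if $w^{ -1}$ is fireworks. A strict partition has distinct nonzero parts. -}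

module Defs where

open import Data.Nat using (ℕ; zero; suc; _≤_; _<_; _>_; _≥_; _∸_; _<ᵇ_; _≤?_)
open import Data.Bool using (if_then_else_)
open import Data.List using (List; []; _∷_; map; length; filter)
open import Data.List.Relation.Unary.All using (All)
open import Data.List.Relation.Unary.Linked using (Linked)
open import Data.Fin using (Fin; toℕ; _<?_) renaming (_<_ to _<ᶠ_)
open import Data.Fin.Permutation using (Permutation′; _⟨$⟩ʳ_; _⟨$⟩ˡ_)
open import Data.Product using (_×_)
open import Relation.Nullary.Decidable using (_×-dec_)
open import Relation.Binary.PropositionalEquality using (_≡_; _≢_)
open import Data.List using (allFin) public

IsPartition : List ℕ → Set
IsPartition lam = Linked _≥_ lam × All (0 <_) lam

IsStrict : List ℕ → Set
IsStrict lam = Linked _>_ lam × All (0 <_) lam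

-- part lam k = λ_{k+1} (0-indexed), with λ_i = 0 beyond the length.
part : List ℕ → ℕ → ℕ
part []        _       = 0
part (x ∷ _)   zero    = x
part (_ ∷ xs)  (suc k) = part xs k

-- One-line notation of a permutation of {0,…,N-1} (0-indexed values).
oneLine : {N : ℕ} → Permutation′ N → List ℕ
oneLine {N} w = map (λ i → toℕ (w ⟨$⟩ʳ i)) (allFin N)

oneLineInv : {N : ℕ} → Permutation′ N → List ℕ
oneLineInv {N} w = map (λ i → toℕ (w ⟨$⟩ˡ i)) (allFin N)

decRuns : List ℕ → List (List ℕ)
decRuns [] = []
decRuns (x ∷ xs) with decRuns xs
... | [] = (x ∷ []) ∷ []
... | [] ∷ rs = (x ∷ []) ∷ [] ∷ rs
... | (y ∷ r) ∷ rs = if y <ᵇ x then (x ∷ y ∷ r) ∷ rs else (x ∷ []) ∷ (y ∷ r) ∷ rs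

initials : List (List ℕ) → List ℕ
initials [] = []
initials ([] ∷ rs) = initials rs
initials ((x ∷ _) ∷ rs) = x ∷ initials rs

IsFireworksList : List ℕ → Set
IsFireworksList u = Linked _<_ (initials (decRuns u))

IsFireworks : {N : ℕ} → Permutation′ N → Set
IsFireworks w = IsFireworksList (oneLine w)

IsInverseFireworks : {N : ℕ} → Permutation′ N → Set
IsInverseFireworks w = IsFireworksList (oneLineInv w)

-- n-Grassmannian (0-indexed positions p, q = p+1; 1-indexed condition i = p+1 ≠ n).
IsGrassmannian : {N : ℕ} → ℕ → Permutation′ N → Set
IsGrassmannian {N} n w =
  (p q : Fin N) → toℕ q ≡ suc (toℕ p) → toℕ q ≢ n → (w ⟨$⟩ʳ p) <ᶠ (w ⟨$⟩ʳ q)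

-- Number of positions v (0-indexed, v ≥ n, i.e. 1-indexed v > n) with w(v) < w(j).
countBelow : {N : ℕ} → ℕ → Permutation′ N → Fin N → ℕ
countBelow {N} n w j =
  length (filter (λ v → (n ≤? toℕ v) ×-dec ((w ⟨$⟩ʳ v) <? (w ⟨$⟩ʳ j))) (allFin N))

-- For each 1 ≤ i ≤ n, exactly λ_i values v > n with w(v) < w(n+1-i).
-- 0-indexed: position j = n - i (so j < n), and λ_i = part lam (n ∸ suc j).
HasShape : {N : ℕ} → ℕ → List ℕ → Permutation′ N → Set
HasShape {N} n lam w =
  (j : Fin N) → toℕ j < n → countBelow n w j ≡ part lam (n ∸ suc (toℕ j))

IsWLambdaN : {N : ℕ} → ℕ → List ℕ → Permutation′ N → Set
IsWLambdaN n lam w = IsGrassmannian n w × HasShape n lam w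

-- A word is fireworks iff each of its weak ascents ends in a strict left-to-right
-- maximum.  The inverse u of an n-Grassmannian permutation w is a shuffle of the
-- increasing words of small (< n) and large (≥ n) positions, so this fails exactly
-- when some large entry of u is later followed by two adjacent small entries
-- u(k) = a, u(k+1) = a+1.  Then w(a+1) = w(a)+1: no large position takes a value
-- between w(a) and w(a+1), which says that the corresponding consecutive parts of
-- λ are equal, and the earlier large entry makes them nonzero.

module Submission where

open import Defs
open import Data.Bool using (true; false; if_then_else_)
open import Data.Empty using (⊥-elim)
open import Data.Fin using (Fin; toℕ; fromℕ<; zero; suc)
open import Data.Fin.Permutation using (Permutation′; _⟨$⟩ʳ_; _⟨$⟩ˡ_; inverseˡ; inverseʳ)
open import Data.Fin.Properties using (toℕ<n; toℕ-fromℕ<; fromℕ<-toℕ; fromℕ<-cong)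
open import Data.List using (List; []; _∷_; applyUpTo; filter; length; tabulate)
open import Data.List.Properties
  using (filter-reject; filter-notAll; filter-some; filter-≐; map-tabulate)
open import Data.List.Membership.Propositional using (_∈_)
open import Data.List.Membership.Propositional.Properties using (∈-filter⁺; ∈-filter⁻; ∈-allFin)
open import Data.List.Relation.Unary.All using (All; _∷_)
import Data.List.Relation.Unary.All as All
open import Data.List.Relation.Unary.Any using (here)
import Data.List.Relation.Unary.Any as Any
open import Data.List.Relation.Unary.Linked using (Linked; []; [-]; _∷_)
open import Data.Nat
open import Data.Nat.Properties
open import Data.Product using (_×_; _,_; proj₁; proj₂; ∃; ∃₂)
open import Data.Sum using (_⊎_; inj₁; inj₂)
open import Function using (_∘_; id)
open import Function.Bundles using (_⇔_; mk⇔; Equivalence)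
open import Function.Construct.Composition using (_⇔-∘_)
open import Function.Construct.Symmetry using (⇔-sym)
open import Function.Related.Propositional using (module EquationalReasoning)
open import Function.Related.TypeIsomorphisms using (¬-cong-⇔)
open import Level using (0ℓ)
open import Relation.Binary using (tri<; tri≈; tri>)
open import Relation.Binary.PropositionalEquality
  using (_≡_; _≢_; refl; cong; cong₂; sym; trans; subst; subst₂; module ≡-Reasoning)
open import Relation.Nullary using (¬_; yes; no)
open import Relation.Nullary.Decidable using (_×-dec_)
open import Relation.Nullary.Reflects using (ofʸ; ofⁿ)
open import Relation.Unary using (Pred; Decidable)

ascentTops : ℕ → List ℕ → List ℕ
ascentTops p []      = []
ascentTops p (y ∷ t) = if y <ᵇ p then ascentTops y t else y ∷ ascentTops y t

decRuns-∷ : ∀ x t → ∃₂ λ r rs → decRuns (x ∷ t) ≡ (x ∷ r) ∷ rs × initials rs ≡ ascentTops x t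
decRuns-∷ x []      = [] , [] , refl , refl
decRuns-∷ x (y ∷ t) with decRuns-∷ y t
... | r , rs , eq , heads rewrite eq with y <ᵇ x
... | true  = y ∷ r , rs , refl , heads
... | false = [] , (y ∷ r) ∷ rs , refl , cong (y ∷_) heads

initials-decRuns : ∀ x t → initials (decRuns (x ∷ t)) ≡ x ∷ ascentTops x t
initials-decRuns x t with decRuns-∷ x t
... | _ , _ , eq , heads rewrite eq = cong (x ∷_) heads

AscentTopsAreRecordsAbove : ℕ → (ℕ → ℕ) → ℕ → Set
AscentTopsAreRecordsAbove c f N =
  ∀ {i k} → i ≤ k → suc k < N → f k ≤ f (suc k) → c < f (suc k) × f i < f (suc k)

AscentTopsAreRecords : (ℕ → ℕ) → ℕ → Set
AscentTopsAreRecords f N = ∀ {i k} → i ≤ k → suc k < N → f k ≤ f (suc k) → f i < f (suc k)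

-- Here c is the latest run head and f 0 the entry just read, so f 0 ≤ c.
linked-ascentTops⇒records : ∀ m f {c} → f 0 ≤ c →
  Linked _<_ (c ∷ ascentTops (f 0) (applyUpTo (f ∘ suc) m)) → AscentTopsAreRecordsAbove c f (suc m)
linked-ascentTops⇒records zero    f _ _ _ (s≤s ()) _
linked-ascentTops⇒records (suc m) f {c} f0≤c heads
  with f 1 <ᵇ f 0 | <ᵇ-reflects-< (f 1) (f 0)
... | true | ofʸ f1<f0 = records
  where
    tail = linked-ascentTops⇒records m (f ∘ suc) (≤-trans (<⇒≤ f1<f0) f0≤c) heads
    records : AscentTopsAreRecordsAbove c f (suc (suc m))
    records {k = zero}  _         _           ascent = ⊥-elim (<⇒≱ f1<f0 ascent)
    records {zero}  {suc k} _     (s≤s k<m) ascent =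
      let (c<top , _) = tail (z≤n {k}) k<m ascent in c<top , ≤-<-trans f0≤c c<top
    records {suc i} {suc k} (s≤s i≤k) (s≤s k<m) ascent = tail i≤k k<m ascent
... | false | ofⁿ _ with heads
... | c<f1 ∷ heads′ = records
  where
    tail = linked-ascentTops⇒records m (f ∘ suc) ≤-refl heads′
    records : AscentTopsAreRecordsAbove c f (suc (suc m))
    records {zero}  {zero}  _         _         _      = c<f1 , ≤-<-trans f0≤c c<f1
    records {zero}  {suc k} _         (s≤s k<m) ascent =
      let (f1<top , _) = tail (z≤n {k}) k<m ascent
      in  <-trans c<f1 f1<top , ≤-<-trans f0≤c (<-trans c<f1 f1<top)
    records {suc i} {suc k} (s≤s i≤k) (s≤s k<m) ascent =
      let (f1<top , fi<top) = tail i≤k k<m ascent in <-trans c<f1 f1<top , fi<top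

records⇒linked-ascentTops : ∀ m f {c} →
  AscentTopsAreRecordsAbove c f (suc m) → Linked _<_ (c ∷ ascentTops (f 0) (applyUpTo (f ∘ suc) m))
records⇒linked-ascentTops zero    f records = [-]
records⇒linked-ascentTops (suc m) f records with f 1 <ᵇ f 0 | <ᵇ-reflects-< (f 1) (f 0)
... | true  | ofʸ _    =
  records⇒linked-ascentTops m (f ∘ suc) λ i≤k k<m → records (s≤s i≤k) (s≤s k<m)
... | false | ofⁿ f1≮f0 =
  proj₁ (records z≤n (s≤s (s≤s z≤n)) (≮⇒≥ f1≮f0)) ∷
  records⇒linked-ascentTops m (f ∘ suc) λ i≤k k<m ascent →
    proj₂ (records (s≤s z≤n) (s≤s k<m) ascent) , proj₂ (records (s≤s i≤k) (s≤s k<m) ascent)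

records⇔recordsAbove : ∀ f N → AscentTopsAreRecords f N ⇔ AscentTopsAreRecordsAbove (f 0) f N
records⇔recordsAbove f N =
  mk⇔ (λ records {_} {k} i≤k k<N ascent → records (z≤n {k}) k<N ascent , records i≤k k<N ascent)
      (λ records {_} {_} i≤k k<N ascent → proj₂ (records i≤k k<N ascent))

fireworks⇔ascentTopsAreRecords : ∀ f N → IsFireworksList (applyUpTo f N) ⇔ AscentTopsAreRecords f N
fireworks⇔ascentTopsAreRecords f zero    = mk⇔ (λ { _ _ () }) (λ _ → [])
fireworks⇔ascentTopsAreRecords f (suc m) rewrite initials-decRuns (f 0) (applyUpTo (f ∘ suc) m) =
  ⇔-sym (records⇔recordsAbove f (suc m))
    ⇔-∘ mk⇔ (linked-ascentTops⇒records m f ≤-refl) (records⇒linked-ascentTops m f)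

IsShuffle : ℕ → (ℕ → ℕ) → ℕ → Set
IsShuffle n f N = ∀ {a b} → a < b → b < N →
  (f a < n → f b < n → f a < f b) × (n ≤ f a → n ≤ f b → f a < f b)

LargeThenAdjacentSmalls : ℕ → (ℕ → ℕ) → ℕ → Set
LargeThenAdjacentSmalls n f N =
  ∃₂ λ i k → i < k × suc k < N × n ≤ f i × f k < n × f (suc k) < n

shuffle-records⇔¬largeThenAdjacentSmalls : ∀ {n f N} → IsShuffle n f N →
  AscentTopsAreRecords f N ⇔ (¬ LargeThenAdjacentSmalls n f N)
shuffle-records⇔¬largeThenAdjacentSmalls {n} {f} {N} shuffle = mk⇔ noPattern records
  where
    noPattern : AscentTopsAreRecords f N → ¬ LargeThenAdjacentSmalls n f N
    noPattern records (i , k , i<k , k+1<N , large , small , small′) =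
      <⇒≱ (<-trans (records (<⇒≤ i<k) k+1<N (<⇒≤ smalls<)) small′) large
      where smalls< = proj₁ (shuffle (n<1+n k) k+1<N) small small′

    records : ¬ LargeThenAdjacentSmalls n f N → AscentTopsAreRecords f N
    records noPattern {i} {k} i≤k k+1<N ascent with n ≤? f (suc k) | n ≤? f i
    ... | yes top-large | yes i-large = proj₂ (shuffle (s≤s i≤k) k+1<N) i-large top-large
    ... | yes top-large | no  i-small = <-≤-trans (≰⇒> i-small) top-large
    ... | no  top-small | no  i-small =
      proj₁ (shuffle (s≤s i≤k) k+1<N) (≰⇒> i-small) (≰⇒> top-small)
    ... | no  top-small | yes i-large with m≤n⇒m<n∨m≡n i≤k
    ...   | inj₁ i<k  = ⊥-elim (noPattern (i , k , i<k , k+1<N , i-large , k-small , ≰⇒> top-small))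
      where k-small = ≤-<-trans ascent (≰⇒> top-small)
    ...   | inj₂ refl = ⊥-elim (top-small (≤-trans i-large ascent))

IncreasingOn : (ℕ → ℕ) → ℕ → ℕ → Set
IncreasingOn f lo hi = ∀ {a b} → lo ≤ a → a < b → b < hi → f a < f b

increasingOn-fromSteps : ∀ {f lo hi} →
  (∀ {a} → lo ≤ a → suc a < hi → f a < f (suc a)) → IncreasingOn f lo hi
increasingOn-fromSteps step {a} {suc b} lo≤a a<b+1 b+1<hi with m≤n⇒m<n∨m≡n (s≤s⁻¹ a<b+1)
... | inj₂ refl = step lo≤a b+1<hi
... | inj₁ a<b  = <-trans (increasingOn-fromSteps step lo≤a a<b (<-trans (n<1+n b) b+1<hi))
                          (step (≤-trans lo≤a (<⇒≤ a<b)) b+1<hi)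

increasingOn-reflects : ∀ {f lo hi a b} → IncreasingOn f lo hi →
  lo ≤ a → lo ≤ b → a < hi → b < hi → f a < f b → a < b
increasingOn-reflects {a = a} {b} increasing _ lo≤b a<hi _ fa<fb with <-cmp a b
... | tri< a<b _ _ = a<b
... | tri≈ _ refl _ = ⊥-elim (<-irrefl refl fa<fb)
... | tri> _ _ b<a = ⊥-elim (<-asym fa<fb (increasing lo≤b b<a a<hi))

module _ {A : Set} {P Q : Pred A 0ℓ} (P? : Decidable P) (Q? : Decidable Q) where

  filter-⊆-absorbs : (∀ {x} → P x → Q x) → ∀ xs → filter P? (filter Q? xs) ≡ filter P? xs
  filter-⊆-absorbs P⊆Q []       = refl
  filter-⊆-absorbs P⊆Q (x ∷ xs) with Q? x
  ... | yes _ with P? x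
  ...   | yes _ = cong (x ∷_) (filter-⊆-absorbs P⊆Q xs)
  ...   | no  _ = filter-⊆-absorbs P⊆Q xs
  filter-⊆-absorbs P⊆Q (x ∷ xs) | no ¬qx =
    trans (filter-⊆-absorbs P⊆Q xs) (sym (filter-reject P? (¬qx ∘ P⊆Q)))

  length-filter-< : (∀ {x} → P x → Q x) → ∀ {x xs} → x ∈ xs → Q x → ¬ P x →
                    length (filter P? xs) < length (filter Q? xs)
  length-filter-< P⊆Q {x} {xs} x∈xs qx ¬px = begin-strict
    length (filter P? xs)               ≡⟨ cong length (filter-⊆-absorbs P⊆Q xs) ⟨
    length (filter P? (filter Q? xs))   <⟨ filter-notAll P? _ (Any.map (λ { refl → ¬px }) x∈filter) ⟩
    length (filter Q? xs)               ∎
    where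
      open ≤-Reasoning
      x∈filter = ∈-filter⁺ Q? x∈xs qx

module _ {A : Set} {P : Pred A 0ℓ} (P? : Decidable P) where

  filter-nonempty : ∀ xs → 0 < length (filter P? xs) → ∃ P
  filter-nonempty xs _ with filter P? xs in eq
  ... | x ∷ _ = x , proj₂ (∈-filter⁻ P? {xs = xs} (subst (x ∈_) (sym eq) (here refl)))

tabulate≡applyUpTo : ∀ {N} (g : Fin N → ℕ) (f : ℕ → ℕ) →
                     (∀ i → g i ≡ f (toℕ i)) → tabulate g ≡ applyUpTo f N
tabulate≡applyUpTo {zero}  g f g≗f = refl
tabulate≡applyUpTo {suc N} g f g≗f =
  cong₂ _∷_ (g≗f zero) (tabulate≡applyUpTo (g ∘ suc) (f ∘ suc) (g≗f ∘ suc))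

-- Arguments outside Fin N are sent to the junk value 0.
extendℕ : ∀ {N} → (Fin N → Fin N) → ℕ → ℕ
extendℕ {N} g k with k <? N
... | yes k<N = toℕ (g (fromℕ< k<N))
... | no  _   = 0

module _ {N : ℕ} (g : Fin N → Fin N) where

  extendℕ-fromℕ< : ∀ {k} (k<N : k < N) → extendℕ g k ≡ toℕ (g (fromℕ< k<N))
  extendℕ-fromℕ< {k} k<N with k <? N
  ... | yes k<N′ = cong (toℕ ∘ g) (fromℕ<-cong k k refl k<N′ k<N)
  ... | no  k≮N  = ⊥-elim (k≮N k<N)

  extendℕ-toℕ : ∀ i → extendℕ g (toℕ i) ≡ toℕ (g i)
  extendℕ-toℕ i = trans (extendℕ-fromℕ< (toℕ<n i)) (cong (toℕ ∘ g) (fromℕ<-toℕ i (toℕ<n i)))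

  extendℕ-< : ∀ {k} → k < N → extendℕ g k < N
  extendℕ-< k<N = subst (_< N) (sym (extendℕ-fromℕ< k<N)) (toℕ<n _)

extendℕ-inverse : ∀ {N} {g h : Fin N → Fin N} → (∀ i → h (g i) ≡ i) →
                  ∀ {k} → k < N → extendℕ h (extendℕ g k) ≡ k
extendℕ-inverse {g = g} {h} h∘g≗id {k} k<N = begin
  extendℕ h (extendℕ g k)               ≡⟨ cong (extendℕ h) (extendℕ-fromℕ< g k<N) ⟩
  extendℕ h (toℕ (g (fromℕ< k<N)))      ≡⟨ extendℕ-toℕ h _ ⟩
  toℕ (h (g (fromℕ< k<N)))              ≡⟨ cong toℕ (h∘g≗id _) ⟩
  toℕ (fromℕ< k<N)                      ≡⟨ toℕ-fromℕ< k<N ⟩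
  k                                     ∎
  where open ≡-Reasoning

RepeatedPart : List ℕ → Set
RepeatedPart lam = ∃ λ t → part lam t ≡ part lam (suc t) × 0 < part lam (suc t)

part-positive⇒< : ∀ lam {t} → 0 < part lam t → t < length lam
part-positive⇒< (x ∷ lam) {zero}  _        = s≤s z≤n
part-positive⇒< (x ∷ lam) {suc t} positive = s≤s (part-positive⇒< lam positive)

complement-index : ∀ {n t} → suc t < n →
  suc (n ∸ suc (suc t)) < n × n ∸ suc (suc (n ∸ suc (suc t))) ≡ t
complement-index {n} {t} t+1<n = subst (suc (suc a) ≤_) a+t+2≡n (s≤s (s≤s (m≤m+n a t))) ,
                                 subst (λ m → m ∸ suc (suc a) ≡ t) a+t+2≡n (m+n∸m≡n a t)
  where
    a = n ∸ suc (suc t)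
    a+t+2≡n : suc (suc (a + t)) ≡ n
    a+t+2≡n = trans (sym (trans (+-suc a (suc t)) (cong suc (+-suc a t)))) (m∸n+n≡m t+1<n)

decreasing⇒¬repeatedPart : ∀ {lam} → Linked _>_ lam → ¬ RepeatedPart lam
decreasing⇒¬repeatedPart {x ∷ y ∷ _} (y<x ∷ _) (zero , x≡y , _) = <-irrefl (sym x≡y) y<x
decreasing⇒¬repeatedPart (_ ∷ decreasing) (suc t , repeated) =
  decreasing⇒¬repeatedPart decreasing (t , repeated)

¬repeatedPart⇒decreasing : ∀ {lam} → Linked _≥_ lam → All (0 <_) lam →
                           ¬ RepeatedPart lam → Linked _>_ lam
¬repeatedPart⇒decreasing []  _ _ = []
¬repeatedPart⇒decreasing [-] _ _ = [-]
¬repeatedPart⇒decreasing (y≤x ∷ weak) (_ ∷ positive) noRepeat with m≤n⇒m<n∨m≡n y≤x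
... | inj₁ y<x  =
  y<x ∷ ¬repeatedPart⇒decreasing weak positive λ (t , repeated) → noRepeat (suc t , repeated)
... | inj₂ refl = ⊥-elim (noRepeat (zero , refl , All.head positive))

strict⇔¬repeatedPart : ∀ {lam} → IsPartition lam → IsStrict lam ⇔ (¬ RepeatedPart lam)
strict⇔¬repeatedPart (weak , positive) =
  mk⇔ (decreasing⇒¬repeatedPart ∘ proj₁)
      (λ noRepeat → ¬repeatedPart⇒decreasing weak positive noRepeat , positive)

module Grassmannian {n N : ℕ} (n≤N : n ≤ N) (w : Permutation′ N)
                   (grassmannian : IsGrassmannian n w) where

  val pos : ℕ → ℕ
  val = extendℕ (w ⟨$⟩ʳ_)
  pos = extendℕ (w ⟨$⟩ˡ_)

  pos-val : ∀ {k} → k < N → pos (val k) ≡ k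
  pos-val = extendℕ-inverse (λ _ → inverseˡ w)

  val-pos : ∀ {k} → k < N → val (pos k) ≡ k
  val-pos = extendℕ-inverse (λ _ → inverseʳ w)

  oneLineInv≡applyUpTo-pos : oneLineInv w ≡ applyUpTo pos N
  oneLineInv≡applyUpTo-pos =
    trans (map-tabulate id _) (tabulate≡applyUpTo _ pos (λ i → sym (extendℕ-toℕ _ i)))

  val-step : ∀ {a} → suc a < N → suc a ≢ n → val a < val (suc a)
  val-step {a} a+1<N a+1≢n
    rewrite extendℕ-fromℕ< (w ⟨$⟩ʳ_) a+1<N | extendℕ-fromℕ< (w ⟨$⟩ʳ_) (<-trans (n<1+n a) a+1<N) =
    grassmannian _ _ (trans (toℕ-fromℕ< _) (cong suc (sym (toℕ-fromℕ< _))))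
                     (a+1≢n ∘ trans (sym (toℕ-fromℕ< _)))

  val-increasing-small : IncreasingOn val 0 n
  val-increasing-small = increasingOn-fromSteps λ _ a+1<n → val-step (≤-trans a+1<n n≤N) (<⇒≢ a+1<n)

  val-increasing-large : IncreasingOn val n N
  val-increasing-large = increasingOn-fromSteps λ n≤a a+1<N → val-step a+1<N (<⇒≢ (s≤s n≤a) ∘ sym)

  val-reflects-small : ∀ {b c} → b < n → c < n → val b < val c → b < c
  val-reflects-small = increasingOn-reflects val-increasing-small z≤n z≤n

  pos-isShuffle : IsShuffle n pos N
  pos-isShuffle {a} {b} a<b b<N = small , large
    where
      a<N = <-trans a<b b<N
      values< : val (pos a) < val (pos b)
      values< = subst₂ _<_ (sym (val-pos a<N)) (sym (val-pos b<N)) a<b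
      small : pos a < n → pos b < n → pos a < pos b
      small a-small b-small = val-reflects-small a-small b-small values<
      large : n ≤ pos a → n ≤ pos b → pos a < pos b
      large a-large b-large = increasingOn-reflects val-increasing-large a-large b-large
                                (extendℕ-< _ a<N) (extendℕ-< _ b<N) values<

  LargeBelow : ℕ → Pred (Fin N) 0ℓ
  LargeBelow x v = n ≤ toℕ v × toℕ (w ⟨$⟩ʳ v) < x

  largeBelow? : ∀ x → Decidable (LargeBelow x)
  largeBelow? x v = (n ≤? toℕ v) ×-dec (toℕ (w ⟨$⟩ʳ v) <? x)

  largeBelow : ℕ → ℕ
  largeBelow x = length (filter (largeBelow? x) (allFin N))

  largeBelow-val : ∀ {a} (a<N : a < N) → largeBelow (val a) ≡ countBelow n w (fromℕ< a<N)
  largeBelow-val a<N = cong largeBelow (extendℕ-fromℕ< _ a<N)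

  largeBelow-suc : ∀ {x} → pos x < n → largeBelow (suc x) ≡ largeBelow x
  largeBelow-suc {x} x-small =
    cong length (filter-≐ (largeBelow? (suc x)) (largeBelow? x) (below-x , below-suc-x) (allFin N))
    where
      below-x : ∀ {v} → LargeBelow (suc x) v → LargeBelow x v
      below-x {v} (large , below) with m≤n⇒m<n∨m≡n (s≤s⁻¹ below)
      ... | inj₁ below′ = large , below′
      ... | inj₂ refl   = ⊥-elim (<⇒≱ x-small (subst (n ≤_) (sym pos-w-v) large))
        where pos-w-v = trans (extendℕ-toℕ _ _) (cong toℕ (inverseˡ w))
      below-suc-x : ∀ {v} → LargeBelow x v → LargeBelow (suc x) v
      below-suc-x (large , below) = large , m<n⇒m<1+n below

  largeBelow-< : ∀ {p x y} → p < N → n ≤ p → x ≤ val p → val p < y → largeBelow x < largeBelow y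
  largeBelow-< {p} {x} {y} p<N large x≤val val<y =
    length-filter-< (largeBelow? x) (largeBelow? y)
      (λ (l , b) → l , <-≤-trans b (≤-trans x≤val (<⇒≤ val<y)))
      (∈-allFin v) (subst (n ≤_) (sym toℕv) large , subst (_< y) valv val<y)
      (λ (_ , b) → <⇒≱ b (subst (x ≤_) valv x≤val))
    where
      v = fromℕ< p<N
      toℕv : toℕ v ≡ p
      toℕv = toℕ-fromℕ< p<N
      valv : val p ≡ toℕ (w ⟨$⟩ʳ v)
      valv = extendℕ-fromℕ< _ p<N

  largeBelow-positive⇔ : ∀ {x} → 0 < largeBelow x ⇔ ∃ λ p → p < N × n ≤ p × val p < x
  largeBelow-positive⇔ {x} = mk⇔ witness positive
    where
      witness : 0 < largeBelow x → ∃ λ p → p < N × n ≤ p × val p < x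
      witness nonzero with filter-nonempty (largeBelow? x) (allFin N) nonzero
      ... | v , large , below = toℕ v , toℕ<n v , large , subst (_< x) (sym (extendℕ-toℕ _ v)) below
      positive : (∃ λ p → p < N × n ≤ p × val p < x) → 0 < largeBelow x
      positive (p , p<N , large , below) =
        filter-some (largeBelow? x) (Any.map (λ { refl → v-large , v-below }) (∈-allFin v))
        where
          v = fromℕ< p<N
          v-large = subst (n ≤_) (sym (toℕ-fromℕ< p<N)) large
          v-below = subst (_< x) (extendℕ-fromℕ< _ p<N) below

  between-adjacent-small-is-large : ∀ {a x} → suc a < n → val a < x → x < val (suc a) → n ≤ pos x
  between-adjacent-small-is-large {a} {x} a+1<n after before = ≮⇒≥ λ x-small →
    <⇒≱ (val-reflects-small (<-trans (n<1+n a) a+1<n) x-small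
                             (subst (val a <_) (sym valposx) after))
        (s≤s⁻¹ (val-reflects-small x-small a+1<n (subst (_< val (suc a)) (sym valposx) before)))
    where
      valposx : val (pos x) ≡ x
      valposx = val-pos (<-trans before (extendℕ-< _ (≤-trans a+1<n n≤N)))

  adjacent-or-gap : ∀ {a} → suc a < n →
    val (suc a) ≡ suc (val a) ⊎ (suc (val a) < val (suc a) × n ≤ pos (suc (val a)))
  adjacent-or-gap {a} a+1<n with m≤n⇒m<n∨m≡n (val-increasing-small z≤n (n<1+n a) a+1<n)
  ... | inj₂ adjacent = inj₁ (sym adjacent)
  ... | inj₁ gap      = inj₂ (gap , between-adjacent-small-is-large a+1<n (n<1+n (val a)) gap)

  module _ (lam : List ℕ) (shape : HasShape n lam w) where

    largeBelow-part : ∀ {a} → a < n → largeBelow (val a) ≡ part lam (n ∸ suc a)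
    largeBelow-part {a} a<n = begin
      largeBelow (val a)                     ≡⟨ largeBelow-val a<N ⟩
      countBelow n w (fromℕ< a<N)            ≡⟨ shape _ (subst (_< n) (sym (toℕ-fromℕ< a<N)) a<n) ⟩
      part lam (n ∸ suc (toℕ (fromℕ< a<N)))  ≡⟨ cong (λ j → part lam (n ∸ suc j)) (toℕ-fromℕ< a<N) ⟩
      part lam (n ∸ suc a)                   ∎
      where
        open ≡-Reasoning
        a<N = ≤-trans a<n n≤N

    largeBelow-adjacent-parts : ∀ {a} → suc a < n →
      largeBelow (val a) ≡ part lam (suc (n ∸ suc (suc a))) ×
      largeBelow (val (suc a)) ≡ part lam (n ∸ suc (suc a))
    largeBelow-adjacent-parts {a} a+1<n =
      trans (largeBelow-part (<-trans (n<1+n a) a+1<n)) (cong (part lam) (+-∸-assoc 1 a+1<n)) ,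
      largeBelow-part a+1<n

    pattern⇒repeatedPart : LargeThenAdjacentSmalls n pos N → RepeatedPart lam
    pattern⇒repeatedPart (i , k , i<k , k+1<N , i-large , k-small , k+1-small) =
      t , repeated , positive
      where
        k<N = <-trans (n<1+n k) k+1<N
        a = pos k
        t = n ∸ suc (suc a)
        val-a : val a ≡ k
        val-a = val-pos k<N
        a+1<n : suc a < n
        a+1<n = ≤-<-trans (val-reflects-small k-small k+1-small
                             (subst₂ _<_ (sym val-a) (sym (val-pos k+1<N)) (n<1+n k))) k+1-small
        val-a+1 : val (suc a) ≡ suc k
        val-a+1 with adjacent-or-gap a+1<n
        ... | inj₁ adjacent    = trans adjacent (cong suc val-a)
        ... | inj₂ (_ , large) = ⊥-elim (<⇒≱ k+1-small (subst (λ x → n ≤ pos (suc x)) val-a large))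
        parts = largeBelow-adjacent-parts a+1<n
        repeated : part lam t ≡ part lam (suc t)
        repeated = begin
          part lam t                 ≡⟨ proj₂ parts ⟨
          largeBelow (val (suc a))   ≡⟨ cong largeBelow val-a+1 ⟩
          largeBelow (suc k)         ≡⟨ largeBelow-suc k-small ⟩
          largeBelow k               ≡⟨ cong largeBelow val-a ⟨
          largeBelow (val a)         ≡⟨ proj₁ parts ⟩
          part lam (suc t)           ∎
          where open ≡-Reasoning
        positive : 0 < part lam (suc t)
        positive = subst (0 <_) (proj₁ parts) (Equivalence.from largeBelow-positive⇔
          (pos i , extendℕ-< _ (<-trans i<k k<N) , i-large ,
           subst₂ _<_ (sym (val-pos (<-trans i<k k<N))) (sym val-a) i<k))

    repeatedPart⇒pattern : length lam ≤ n → RepeatedPart lam → LargeThenAdjacentSmalls n pos N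
    repeatedPart⇒pattern length≤n (t , repeated , positive) =
      val p , val a , val-p<val-a , a+1-value<N , p-large′ , a-small′ , a+1-small′
      where
        t+1<n = <-≤-trans (part-positive⇒< lam positive) length≤n
        a = n ∸ suc (suc t)
        a+1<n = proj₁ (complement-index t+1<n)
        a<N = ≤-trans (<-trans (n<1+n a) a+1<n) n≤N
        a+1<N = ≤-trans a+1<n n≤N
        parts : largeBelow (val a) ≡ part lam (suc t) × largeBelow (val (suc a)) ≡ part lam t
        parts with largeBelow-adjacent-parts a+1<n
        ... | parts-a , parts-a+1 rewrite proj₂ (complement-index t+1<n) = parts-a , parts-a+1
        equal-counts : largeBelow (val a) ≡ largeBelow (val (suc a))
        equal-counts = trans (proj₁ parts) (trans (sym repeated) (sym (proj₂ parts)))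
        adjacent : val (suc a) ≡ suc (val a)
        adjacent with adjacent-or-gap a+1<n
        ... | inj₁ adjacent′         = adjacent′
        ... | inj₂ (gap , gap-large) = ⊥-elim (<-irrefl equal-counts
              (largeBelow-< (extendℕ-< _ gap<N) gap-large (subst (val a ≤_) (sym val-gap) (n≤1+n _))
                            (subst (_< val (suc a)) (sym val-gap) gap)))
          where
            gap<N = <-trans gap (extendℕ-< _ a+1<N)
            val-gap = val-pos gap<N
        witness = Equivalence.to largeBelow-positive⇔ (subst (0 <_) (sym (proj₁ parts)) positive)
        p = proj₁ witness
        p<N = proj₁ (proj₂ witness)
        val-p<val-a = proj₂ (proj₂ (proj₂ witness))
        a+1-value<N : suc (val a) < N
        a+1-value<N = subst (_< N) adjacent (extendℕ-< _ a+1<N)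
        p-large′ : n ≤ pos (val p)
        p-large′ = subst (n ≤_) (sym (pos-val p<N)) (proj₁ (proj₂ (proj₂ witness)))
        a-small′ : pos (val a) < n
        a-small′ = subst (_< n) (sym (pos-val a<N)) (<-trans (n<1+n a) a+1<n)
        a+1-small′ : pos (suc (val a)) < n
        a+1-small′ = subst (_< n) (trans (sym (pos-val a+1<N)) (cong pos adjacent)) a+1<n

    largeThenAdjacentSmalls⇔repeatedPart : length lam ≤ n →
      LargeThenAdjacentSmalls n pos N ⇔ RepeatedPart lam
    largeThenAdjacentSmalls⇔repeatedPart length≤n =
      mk⇔ pattern⇒repeatedPart (repeatedPart⇒pattern length≤n)

proposition5p7 : (n N : ℕ) (lam : List ℕ) → IsPartition lam → length lam ≤ n → n ≤ N →
                 (w : Permutation′ N) → IsWLambdaN n lam w →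
                 (IsInverseFireworks w ⇔ IsStrict lam)
proposition5p7 n N lam isPartition length≤n n≤N w (grassmannian , shape) = begin
  IsInverseFireworks w                ≡⟨ cong IsFireworksList oneLineInv≡applyUpTo-pos ⟩
  IsFireworksList (applyUpTo pos N)   ∼⟨ fireworks⇔ascentTopsAreRecords pos N ⟩
  AscentTopsAreRecords pos N          ∼⟨ shuffle-records⇔¬largeThenAdjacentSmalls pos-isShuffle ⟩
  ¬ LargeThenAdjacentSmalls n pos N   ∼⟨ ¬-cong-⇔ (largeThenAdjacentSmalls⇔repeatedPart lam shape length≤n) ⟩
  ¬ RepeatedPart lam                  ∼⟨ ⇔-sym (strict⇔¬repeatedPart isPartition) ⟩
  IsStrict lam                        ∎
  where
    open Grassmannian n≤N w grassmannian
    open EquationalReasoning
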